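{- Let $F_e\subseteq E(BS_4)$ with $|F_e|\le 10$. If $BS_4-F_e$ is disconnected, then $BS_4-F_e$ has a component $H$ with $|V(H)|\ge 4!-2$.
   Context: The $n$-dimensional bubble-sort star graph $BS_n$ has as vertex set all permutations $x=x_1x_2\cdots x_n$ of $\{1,\dots,n\}$. Two distinct vertices $x,y$ are adjacent iff there is $k\in\{2,\dots,n\}$ such that $y$ is obtained from $x$ either by swapping the entries in positions $k-1$ and $k$, or by swapping the entries in positions $1$ and $k$. For $F_e\subseteq E(G)$, $G-F_e$ is the graph with vertex set $V(G)$ and edge set $E(G)\setminus F_e$. -}

module Defs where

open import Data.Nat using (ℕ; suc)
open import Data.Fin using (Fin; zero; suc; inject₁)
open import Data.Vec using (Vec; lookup; _[_]≔_; toList)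
open import Data.List using (List)
open import Data.List.Relation.Unary.Unique.Propositional using (Unique)
open import Data.List.Membership.Propositional using (_∈_)
open import Data.Product using (Σ; _×_; _,_)
open import Data.Sum using (_⊎_)
open import Relation.Binary.PropositionalEquality using (_≡_)
open import Relation.Nullary using (¬_)

-- Arrangements of the symbols {1..n} (0-indexed as Fin n) in n positions.
Arr : ℕ → Set
Arr n = Vec (Fin n) n

-- x is a permutation: its n entries are pairwise distinct (hence all of Fin n occur).
IsPerm : {n : ℕ} → Arr n → Set
IsPerm x = Unique (toList x)

swap : {n : ℕ} → Arr n → Fin n → Fin n → Arr n
swap x i j = (x [ i ]≔ lookup x j) [ j ]≔ lookup x i

-- Adjacency in BS_(suc m).  Paper positions k ∈ {2,…,n} correspond to
-- suc k' with k' : Fin m (0-indexed); position k-1 is inject₁ k', position 1 is zero.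
BSAdj : {m : ℕ} → Arr (suc m) → Arr (suc m) → Set
BSAdj {m} x y = Σ (Fin m) λ k →
  (y ≡ swap x (inject₁ k) (suc k)) ⊎ (y ≡ swap x zero (suc k))

-- An edge set is given as a list of (ordered) pairs; a pair (x , y) removes
-- the undirected edge {x , y}.
EdgeList : ℕ → Set
EdgeList n = List (Arr n × Arr n)

AdjMinus : {m : ℕ} → EdgeList (suc m) → Arr (suc m) → Arr (suc m) → Set
AdjMinus F x y = BSAdj x y × ¬ ((x , y) ∈ F) × ¬ ((y , x) ∈ F)

data Reach {m : ℕ} (F : EdgeList (suc m)) (x : Arr (suc m)) : Arr (suc m) → Set where
  here : Reach F x x
  step : {y z : Arr (suc m)} → Reach F x y → AdjMinus F y z → Reach F x z

module Submission where

-- The heart of the argument is a cut property of BS₄: every vertex set whose edge boundary has at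
-- most 10 edges has at most 2 or at least 22 vertices. It is verified by an exhaustive search that
-- decides membership vertex by vertex and abandons a branch as soon as the edges crossing between
-- already decided vertices exceed 10. A union of components of BS₄ − F is such a set, since its
-- boundary lies in F. If every component had at most 2 vertices, adjoining components one at a
-- time to ∅ would produce a union of components with 3 or 4 vertices, contradicting the cut property.

open import Data.Bool using (Bool; true; false; T; _∧_; _∨_; _xor_; if_then_else_)
open import Data.Bool.Properties using (T-∧; T-∨; T-≡; xor-same)
open import Data.Fin using (Fin; zero; suc; inject₁; #_)
open import Data.Fin.Properties using (any?; all?; suc-injective) renaming (_≟_ to _≟ᶠ_; _≤?_ to _≤ᶠ?_)
open import Data.Fin.Subset using (Subset; inside; outside; _∈_; _∉_; _⊆_; ∣_∣; _∪_; ⁅_⁆) renaming (⊥ to ∅)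
open import Data.Fin.Subset.Properties
  using (_∈?_; drop-there; drop-∷-⊆; p⊆q⇒∣p∣≤∣q∣; p⊂q⇒∣p∣<∣q∣; ∣p∣≤n; ∉⊥; x∈⁅x⁆; x∈⁅y⁆⇒x≡y;
         p⊆p∪q; q⊆p∪q; x∈p∪q⁻; x∈p∪q⁺)
open import Data.List using (List; []; _∷_; _++_; _∷ʳ_; [_]; length; map; filterᵇ)
open import Data.List.Properties using (++-identityʳ; ++-assoc; filter-≐; length-map)
open import Data.List.Membership.Propositional using () renaming (_∈_ to _∈ᴸ_)
open import Data.List.Membership.Propositional.Properties using (∈-filter⁻; ∈-map⁺; ∈-∃++; ∈-++⁻; ∈-++⁺ˡ; ∈-++⁺ʳ)
import Data.List.Membership.DecPropositional as DecMembership
open import Data.List.Relation.Binary.Subset.Propositional using () renaming (_⊆_ to _⊆ᴸ_)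
open import Data.List.Relation.Binary.Sublist.Propositional using (⊆-refl)
open import Data.List.Relation.Binary.Sublist.Propositional.Properties using (filter⁺; length-mono-≤)
open import Data.List.Relation.Unary.All as All using (All; []; _∷_)
import Data.List.Relation.Unary.All.Properties as All
open import Data.List.Relation.Unary.Any using (here; there)
open import Data.List.Relation.Unary.Unique.Propositional using (Unique; []; _∷_)
import Data.List.Relation.Unary.Unique.Propositional.Properties as Unique
open import Data.List.Relation.Unary.Unique.DecPropositional using (unique?)
open import Data.Maybe using (Maybe; just; nothing)
open import Data.Nat using (ℕ; zero; suc; _+_; _≤_; _<_; _≥_; _∸_; _!; _≤ᵇ_; _<ᵇ_; z≤n; s≤s)
open import Data.Nat.Properties
  using (≤-refl; ≤-trans; ≤-reflexive; <-≤-trans; <⇒≱; n≮n; n≤1+n; +-suc; +-monoʳ-≤; +-mono-≤; <ᵇ⇒<; ≤ᵇ⇒≤; ≤⇒≤ᵇ)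
  renaming (suc-injective to sucℕ-injective)
open import Data.Product using (Σ; ∃; _×_; _,_; proj₁; proj₂)
import Data.Product.Properties as Product
open import Data.Sum as Sum using (_⊎_; inj₁; inj₂)
open import Data.Unit using (tt)
open import Data.Vec using (Vec; []; _∷_; here; there; lookup; tabulate; toList)
open import Data.Vec.Properties
  using ([]=⇒lookup; lookup⇒[]=; lookup∘tabulate; length-toList) renaming (≡-dec to ≡-decᵛ)
open import Function using (_∘_; id; Equivalence)
open import Relation.Binary.Definitions using (DecidableEquality)
open import Relation.Binary.PropositionalEquality using (_≡_; refl; sym; trans; cong; subst)
open import Relation.Nullary using (¬_; Dec; yes; no; does; contradiction)
open import Relation.Nullary.Decidable
  using (T?; dec-true; isYes≗does; toWitness; decidable-stable; _×-dec_; _⊎-dec_; ¬?; _→-dec_)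
open import Relation.Unary using (Pred; Decidable)

open import Defs

open Equivalence using (to; from)

private variable
  n : ℕ

∣p∪q∣≤∣p∣+∣q∣ : (p q : Subset n) → ∣ p ∪ q ∣ ≤ ∣ p ∣ + ∣ q ∣
∣p∪q∣≤∣p∣+∣q∣ []            []            = z≤n
∣p∪q∣≤∣p∣+∣q∣ (outside ∷ p) (outside ∷ q) = ∣p∪q∣≤∣p∣+∣q∣ p q
∣p∪q∣≤∣p∣+∣q∣ (outside ∷ p) (inside ∷ q)  =
  ≤-trans (s≤s (∣p∪q∣≤∣p∣+∣q∣ p q)) (≤-reflexive (sym (+-suc ∣ p ∣ ∣ q ∣)))
∣p∪q∣≤∣p∣+∣q∣ (inside ∷ p)  (outside ∷ q) = s≤s (∣p∪q∣≤∣p∣+∣q∣ p q)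
∣p∪q∣≤∣p∣+∣q∣ (inside ∷ p)  (inside ∷ q)  =
  s≤s (≤-trans (∣p∪q∣≤∣p∣+∣q∣ p q) (+-monoʳ-≤ ∣ p ∣ (n≤1+n ∣ q ∣)))

p⊆q⇒p≡q⊎∣p∣<∣q∣ : {p q : Subset n} → p ⊆ q → p ≡ q ⊎ ∣ p ∣ < ∣ q ∣
p⊆q⇒p≡q⊎∣p∣<∣q∣ {p = []}          {[]}          _   = inj₁ refl
p⊆q⇒p≡q⊎∣p∣<∣q∣ {p = outside ∷ p} {outside ∷ q} p⊆q =
  Sum.map (cong (outside ∷_)) id (p⊆q⇒p≡q⊎∣p∣<∣q∣ (drop-∷-⊆ p⊆q))
p⊆q⇒p≡q⊎∣p∣<∣q∣ {p = outside ∷ p} {inside ∷ q}  p⊆q = inj₂ (s≤s (p⊆q⇒∣p∣≤∣q∣ (drop-∷-⊆ p⊆q)))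
p⊆q⇒p≡q⊎∣p∣<∣q∣ {p = inside ∷ p}  {outside ∷ q} p⊆q = contradiction (p⊆q here) λ ()
p⊆q⇒p≡q⊎∣p∣<∣q∣ {p = inside ∷ p}  {inside ∷ q}  p⊆q =
  Sum.map (cong (inside ∷_)) s≤s (p⊆q⇒p≡q⊎∣p∣<∣q∣ (drop-∷-⊆ p⊆q))

∣p∣<n⇒∃∉ : (p : Subset n) → ∣ p ∣ < n → ∃ λ x → x ∉ p
∣p∣<n⇒∃∉ (outside ∷ p) _       = zero , λ ()
∣p∣<n⇒∃∉ (inside ∷ p)  (s≤s h) with ∣p∣<n⇒∃∉ p h
... | x , x∉p = suc x , x∉p ∘ drop-there

module _ {p} {P : Pred (Fin n) p} (P? : Decidable P) where

  subsetOf : Subset n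
  subsetOf = tabulate (does ∘ P?)

  lookup-subsetOf : ∀ x → lookup subsetOf x ≡ does (P? x)
  lookup-subsetOf = lookup∘tabulate (does ∘ P?)

  ∈-subsetOf⁺ : ∀ {x} → P x → x ∈ subsetOf
  ∈-subsetOf⁺ {x} px = lookup⇒[]= x subsetOf (trans (lookup-subsetOf x) (dec-true (P? x) px))

  ∈-subsetOf⁻ : ∀ {x} → x ∈ subsetOf → P x
  ∈-subsetOf⁻ {x} x∈ = toWitness {a? = P? x}
    (from T-≡ (trans (isYes≗does (P? x)) (trans (sym (lookup-subsetOf x)) ([]=⇒lookup x∈))))

members : Subset n → List (Fin n)
members []            = []
members (inside ∷ p)  = zero ∷ map suc (members p)
members (outside ∷ p) = map suc (members p)

length-members : (p : Subset n) → length (members p) ≡ ∣ p ∣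
length-members []            = refl
length-members (inside ∷ p)  = cong suc (trans (length-map suc (members p)) (length-members p))
length-members (outside ∷ p) = trans (length-map suc (members p)) (length-members p)

members-∈ : (p : Subset n) → All (_∈ p) (members p)
members-∈ []            = []
members-∈ (inside ∷ p)  = here ∷ All.map⁺ (All.map there (members-∈ p))
members-∈ (outside ∷ p) = All.map⁺ (All.map there (members-∈ p))

members-unique : (p : Subset n) → Unique (members p)
members-unique []            = []
members-unique (inside ∷ p)  =
  All.map⁺ (All.universal (λ _ ()) (members p)) ∷ Unique.map⁺ suc-injective (members-unique p)
members-unique (outside ∷ p) = Unique.map⁺ suc-injective (members-unique p)

length-mono-⊆ᴸ : {A : Set} {xs ys : List A} → Unique xs → xs ⊆ᴸ ys → length xs ≤ length ys
length-mono-⊆ᴸ {xs = []}     _            _     = z≤n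
length-mono-⊆ᴸ {xs = x ∷ xs} (x∉xs ∷ xs!) xs⊆ys with ∈-∃++ (xs⊆ys (here refl))
... | ys₁ , ys₂ , refl =
  ≤-trans (s≤s (length-mono-⊆ᴸ xs! xs⊆ys₁++ys₂)) (≤-reflexive (sym (length-++-∷ ys₁)))
  where
  xs⊆ys₁++ys₂ : xs ⊆ᴸ ys₁ ++ ys₂
  xs⊆ys₁++ys₂ {z} z∈xs with ∈-++⁻ ys₁ (xs⊆ys (there z∈xs))
  ... | inj₁ z∈ys₁          = ∈-++⁺ˡ z∈ys₁
  ... | inj₂ (here refl)    = contradiction refl (All.lookup x∉xs z∈xs)
  ... | inj₂ (there z∈ys₂) = ∈-++⁺ʳ ys₁ z∈ys₂
  length-++-∷ : ∀ zs → length (zs ++ x ∷ ys₂) ≡ suc (length (zs ++ ys₂))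
  length-++-∷ []       = refl
  length-++-∷ (_ ∷ zs) = cong suc (length-++-∷ zs)

module _ (E : List (Fin n × Fin n)) where

  separates : Subset n → Fin n × Fin n → Bool
  separates S (a , b) = lookup S a xor lookup S b

  boundary : Subset n → List (Fin n × Fin n)
  boundary S = filterᵇ (separates S) E

-- A partial assignment P decides membership of the vertices with index below length P.
decided : List Bool → Fin n → Maybe Bool
decided []      _       = nothing
decided (b ∷ _) zero    = just b
decided (_ ∷ P) (suc i) = decided P i

decided-++ : ∀ P Q (i : Fin n) {b} → decided P i ≡ just b → decided (P ++ Q) i ≡ just b
decided-++ (_ ∷ P) Q zero    eq = eq
decided-++ (_ ∷ P) Q (suc i) eq = decided-++ P Q i eq

decided-toList : (S : Subset n) (i : Fin n) → decided (toList S) i ≡ just (lookup S i)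
decided-toList (_ ∷ S) zero    = refl
decided-toList (_ ∷ S) (suc i) = decided-toList S i

trues : List Bool → ℕ
trues []          = zero
trues (true ∷ P)  = suc (trues P)
trues (false ∷ P) = trues P

∣S∣≡trues-toList : (S : Subset n) → ∣ S ∣ ≡ trues (toList S)
∣S∣≡trues-toList []          = refl
∣S∣≡trues-toList (true ∷ S)  = cong suc (∣S∣≡trues-toList S)
∣S∣≡trues-toList (false ∷ S) = ∣S∣≡trues-toList S

differ : Maybe Bool → Maybe Bool → Bool
differ (just x) (just y) = x xor y
differ _        _        = false

module CutSearch (E : List (Fin n × Fin n)) where

  separatesᴾ : List Bool → Fin n × Fin n → Bool
  separatesᴾ P (a , b) = differ (decided P a) (decided P b)

  boundaryᴾ : List Bool → List (Fin n × Fin n)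
  boundaryᴾ P = filterᵇ (separatesᴾ P) E

  separatesᴾ-++ : ∀ P Q e → T (separatesᴾ P e) → T (separatesᴾ (P ++ Q) e)
  separatesᴾ-++ P Q (a , b) sep with decided P a in ea | decided P b in eb
  ... | just x | just y rewrite decided-++ P Q a ea | decided-++ P Q b eb = sep

  boundaryᴾ-mono : ∀ P Q → length (boundaryᴾ P) ≤ length (boundaryᴾ (P ++ Q))
  boundaryᴾ-mono P Q = length-mono-≤ (filter⁺ (T? ∘ separatesᴾ P) (T? ∘ separatesᴾ (P ++ Q))
    (λ { refl → separatesᴾ-++ P Q _ }) (⊆-refl {x = E}))

  boundaryᴾ-toList : (S : Subset n) → boundaryᴾ (toList S) ≡ boundary E S
  boundaryᴾ-toList S = filter-≐ _ _ (subst T (agree _) , subst T (sym (agree _))) E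
    where
    agree : ∀ e → separatesᴾ (toList S) e ≡ separates E S e
    agree (a , b) rewrite decided-toList S a | decided-toList S b = refl

  module _ (bound : ℕ) (good : ℕ → Bool) where

    exceeds : List Bool → Bool
    exceeds P = bound <ᵇ length (boundaryᴾ P)

    search : ℕ → List Bool → Bool
    search zero    P = exceeds P ∨ good (trues P)
    search (suc k) P = exceeds P ∨ (search k (P ∷ʳ true) ∧ search k (P ∷ʳ false))

    unpruned : ∀ P Q {x} → T (exceeds P ∨ x) → length (boundaryᴾ (P ++ Q)) ≤ bound → T x
    unpruned P Q ok ≤bound with to T-∨ ok
    ... | inj₁ exceeded = contradiction ≤bound (<⇒≱ (<-≤-trans (<ᵇ⇒< _ _ exceeded) (boundaryᴾ-mono P Q)))
    ... | inj₂ x        = x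

    search-sound : ∀ k P → T (search k P) → ∀ Q → length Q ≡ k →
                   length (boundaryᴾ (P ++ Q)) ≤ bound → T (good (trues (P ++ Q)))
    search-sound zero P ok [] refl ≤bound =
      subst (T ∘ good ∘ trues) (sym (++-identityʳ P)) (unpruned P [] ok ≤bound)
    search-sound (suc k) P ok (b ∷ Q) len ≤bound =
      subst (T ∘ good ∘ trues) (++-assoc P [ b ] Q)
        (search-sound k (P ∷ʳ b) (branch b) Q (sucℕ-injective len)
          (subst (λ R → length (boundaryᴾ R) ≤ bound) (sym (++-assoc P [ b ] Q)) ≤bound))
      where
      both : T (search k (P ∷ʳ true)) × T (search k (P ∷ʳ false))
      both = to T-∧ (unpruned P (b ∷ Q) ok ≤bound)
      branch : ∀ b → T (search k (P ∷ʳ b))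
      branch true  = proj₁ both
      branch false = proj₂ both

    search-correct : search n [] ≡ true → (S : Subset n) → length (boundary E S) ≤ bound → T (good ∣ S ∣)
    search-correct ok S ≤bound =
      subst (T ∘ good) (sym (∣S∣≡trues-toList S))
        (search-sound n [] (from T-≡ ok) (toList S) (length-toList S)
          (subst (λ B → length B ≤ bound) (sym (boundaryᴾ-toList S)) ≤bound))

module Components (E : List (Fin n × Fin n)) {ℓ} {Open : Pred (Fin n × Fin n) ℓ} (open? : Decidable Open) where

  infix 4 _—_ _—?_

  _—_ : Fin n → Fin n → Set ℓ
  a — b = (a , b) ∈ᴸ E × Open (a , b) ⊎ (b , a) ∈ᴸ E × Open (b , a)

  _—?_ : ∀ a b → Dec (a — b)
  a —? b = ((a , b) ∈ᴸ? E ×-dec open? (a , b)) ⊎-dec ((b , a) ∈ᴸ? E ×-dec open? (b , a))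
    where open DecMembership (Product.≡-dec _≟ᶠ_ _≟ᶠ_) using () renaming (_∈?_ to _∈ᴸ?_)

  Closed : Subset n → Set ℓ
  Closed S = ∀ {a b} → a — b → a ∈ S → b ∈ S

  ∅-closed : Closed ∅
  ∅-closed _ a∈∅ = contradiction a∈∅ ∉⊥

  ∪-closed : ∀ {S T} → Closed S → Closed T → Closed (S ∪ T)
  ∪-closed {S} {T} S-closed T-closed a—b a∈S∪T =
    x∈p∪q⁺ (Sum.map (S-closed a—b) (T-closed a—b) (x∈p∪q⁻ S T a∈S∪T))

  closed-lookup : ∀ {S a b} → Closed S → a — b → lookup S a ≡ lookup S b
  closed-lookup {S} {a} {b} S-closed a—b with lookup S a in ea | lookup S b in eb
  ... | true  | true  = refl
  ... | false | false = refl
  ... | true  | false = trans (sym ([]=⇒lookup (S-closed a—b (lookup⇒[]= a S ea)))) eb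
  ... | false | true  = trans (sym ea) ([]=⇒lookup (S-closed (Sum.swap a—b) (lookup⇒[]= b S eb)))

  closed-boundary : ∀ {S e} → Closed S → e ∈ᴸ boundary E S → ¬ Open e
  closed-boundary {S} {a , b} S-closed e∈∂S open-e with ∈-filter⁻ (T? ∘ separates E S) {xs = E} e∈∂S
  ... | e∈E , sep = subst T (trans (cong (_xor lookup S b) same) (xor-same (lookup S b))) sep
    where
    same : lookup S a ≡ lookup S b
    same = closed-lookup S-closed (inj₁ (e∈E , open-e))

  Reached : Subset n → Pred (Fin n) ℓ
  Reached S b = ∃ λ a → a ∈ S × a — b

  reached? : ∀ S → Decidable (Reached S)
  reached? S b = any? λ a → a ∈? S ×-dec a —? b

  expand : Subset n → Subset n
  expand S = S ∪ subsetOf (reached? S)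

  expand⁺ : ∀ {S a b} → a — b → a ∈ S → b ∈ expand S
  expand⁺ {S} a—b a∈S = q⊆p∪q S _ (∈-subsetOf⁺ (reached? S) (_ , a∈S , a—b))

  expand⁻ : ∀ {S b} → b ∈ expand S → b ∈ S ⊎ Reached S b
  expand⁻ {S} b∈ = Sum.map id (∈-subsetOf⁻ (reached? S)) (x∈p∪q⁻ S _ b∈)

  stable⇒closed : ∀ {S} → expand S ≡ S → Closed S
  stable⇒closed stable a—b a∈S = subst (_ ∈_) stable (expand⁺ a—b a∈S)

  expandⁿ : ℕ → Subset n → Subset n
  expandⁿ zero    S = S
  expandⁿ (suc k) S = expand (expandⁿ k S)

  expandⁿ-stable⊎grows : ∀ k S → expand (expandⁿ k S) ≡ expandⁿ k S ⊎ k ≤ ∣ expandⁿ k S ∣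
  expandⁿ-stable⊎grows zero    S = inj₂ z≤n
  expandⁿ-stable⊎grows (suc k) S with expandⁿ-stable⊎grows k S
  ... | inj₁ stable = inj₁ (cong expand stable)
  ... | inj₂ grown with p⊆q⇒p≡q⊎∣p∣<∣q∣ (p⊆p∪q {p = expandⁿ k S} _)
  ...   | inj₁ same = inj₁ (cong expand (sym same))
  ...   | inj₂ more = inj₂ (≤-trans (s≤s grown) more)

  -- Opaque because unfolding the (n + 1)-fold iteration during unification is prohibitively expensive.
  opaque
    component : Fin n → Subset n
    component r = expandⁿ (suc n) ⁅ r ⁆

    component-closed : ∀ r → Closed (component r)
    component-closed r with expandⁿ-stable⊎grows (suc n) ⁅ r ⁆
    ... | inj₁ stable = stable⇒closed stable
    ... | inj₂ grown  = contradiction (≤-trans grown (∣p∣≤n (component r))) (n≮n n)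

    ∈-component : ∀ r → r ∈ component r
    ∈-component r = expandⁿ-⊇ (suc n) (x∈⁅x⁆ r)
      where
      expandⁿ-⊇ : ∀ k {S} → S ⊆ expandⁿ k S
      expandⁿ-⊇ zero    = id
      expandⁿ-⊇ (suc k) = p⊆p∪q _ ∘ expandⁿ-⊇ k

    component-ind : ∀ {p} (P : Fin n → Set p) {r} → P r → (∀ {a b} → a — b → P a → P b) →
                    ∀ {i} → i ∈ component r → P i
    component-ind P {r} Pr P-step = expandⁿ-ind (suc n) (λ i∈⁅r⁆ → subst P (sym (x∈⁅y⁆⇒x≡y r i∈⁅r⁆)) Pr)
      where
      expandⁿ-ind : ∀ k {S} → (∀ {i} → i ∈ S → P i) → ∀ {i} → i ∈ expandⁿ k S → P i
      expandⁿ-ind zero    PS = PS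
      expandⁿ-ind (suc k) PS i∈ with expand⁻ i∈
      ... | inj₁ i∈S             = expandⁿ-ind k PS i∈S
      ... | inj₂ (a , a∈S , a—i) = P-step a—i (expandⁿ-ind k PS a∈S)

vertices : Vec (Arr 4) 24
vertices =
  (# 0 ∷ # 1 ∷ # 2 ∷ # 3 ∷ []) ∷ (# 0 ∷ # 1 ∷ # 3 ∷ # 2 ∷ []) ∷ (# 0 ∷ # 2 ∷ # 1 ∷ # 3 ∷ []) ∷
  (# 0 ∷ # 2 ∷ # 3 ∷ # 1 ∷ []) ∷ (# 0 ∷ # 3 ∷ # 1 ∷ # 2 ∷ []) ∷ (# 0 ∷ # 3 ∷ # 2 ∷ # 1 ∷ []) ∷
  (# 1 ∷ # 0 ∷ # 2 ∷ # 3 ∷ []) ∷ (# 1 ∷ # 0 ∷ # 3 ∷ # 2 ∷ []) ∷ (# 1 ∷ # 2 ∷ # 0 ∷ # 3 ∷ []) ∷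
  (# 1 ∷ # 2 ∷ # 3 ∷ # 0 ∷ []) ∷ (# 1 ∷ # 3 ∷ # 0 ∷ # 2 ∷ []) ∷ (# 1 ∷ # 3 ∷ # 2 ∷ # 0 ∷ []) ∷
  (# 2 ∷ # 0 ∷ # 1 ∷ # 3 ∷ []) ∷ (# 2 ∷ # 0 ∷ # 3 ∷ # 1 ∷ []) ∷ (# 2 ∷ # 1 ∷ # 0 ∷ # 3 ∷ []) ∷
  (# 2 ∷ # 1 ∷ # 3 ∷ # 0 ∷ []) ∷ (# 2 ∷ # 3 ∷ # 0 ∷ # 1 ∷ []) ∷ (# 2 ∷ # 3 ∷ # 1 ∷ # 0 ∷ []) ∷
  (# 3 ∷ # 0 ∷ # 1 ∷ # 2 ∷ []) ∷ (# 3 ∷ # 0 ∷ # 2 ∷ # 1 ∷ []) ∷ (# 3 ∷ # 1 ∷ # 0 ∷ # 2 ∷ []) ∷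
  (# 3 ∷ # 1 ∷ # 2 ∷ # 0 ∷ []) ∷ (# 3 ∷ # 2 ∷ # 0 ∷ # 1 ∷ []) ∷ (# 3 ∷ # 2 ∷ # 1 ∷ # 0 ∷ []) ∷
  []

vertex : Fin 24 → Arr 4
vertex = lookup vertices

-- All 60 edges of BS₄, as index pairs i < j. Soundness only uses edges-adjacent below; that the
-- list is complete is what makes the cut search succeed.
edges : List (Fin 24 × Fin 24)
edges =
  (# 0 , # 1) ∷ (# 0 , # 2) ∷ (# 0 , # 6) ∷ (# 0 , # 14) ∷ (# 0 , # 21) ∷ (# 1 , # 4) ∷
  (# 1 , # 7) ∷ (# 1 , # 15) ∷ (# 1 , # 20) ∷ (# 2 , # 3) ∷ (# 2 , # 8) ∷ (# 2 , # 12) ∷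
  (# 2 , # 23) ∷ (# 3 , # 5) ∷ (# 3 , # 9) ∷ (# 3 , # 13) ∷ (# 3 , # 22) ∷ (# 4 , # 5) ∷
  (# 4 , # 10) ∷ (# 4 , # 17) ∷ (# 4 , # 18) ∷ (# 5 , # 11) ∷ (# 5 , # 16) ∷ (# 5 , # 19) ∷
  (# 6 , # 7) ∷ (# 6 , # 8) ∷ (# 6 , # 12) ∷ (# 6 , # 19) ∷ (# 7 , # 10) ∷ (# 7 , # 13) ∷
  (# 7 , # 18) ∷ (# 8 , # 9) ∷ (# 8 , # 14) ∷ (# 8 , # 22) ∷ (# 9 , # 11) ∷ (# 9 , # 15) ∷
  (# 9 , # 23) ∷ (# 10 , # 11) ∷ (# 10 , # 16) ∷ (# 10 , # 20) ∷ (# 11 , # 17) ∷ (# 11 , # 21) ∷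
  (# 12 , # 13) ∷ (# 12 , # 14) ∷ (# 12 , # 18) ∷ (# 13 , # 16) ∷ (# 13 , # 19) ∷ (# 14 , # 15) ∷
  (# 14 , # 20) ∷ (# 15 , # 17) ∷ (# 15 , # 21) ∷ (# 16 , # 17) ∷ (# 16 , # 22) ∷ (# 17 , # 23) ∷
  (# 18 , # 19) ∷ (# 18 , # 20) ∷ (# 19 , # 22) ∷ (# 20 , # 21) ∷ (# 21 , # 23) ∷ (# 22 , # 23) ∷
  []

_≟ᴬ_ : DecidableEquality (Arr 4)
_≟ᴬ_ = ≡-decᵛ _≟ᶠ_

bsAdj? : (x y : Arr 4) → Dec (BSAdj x y)
bsAdj? x y = any? λ k → (y ≟ᴬ swap x (inject₁ k) (suc k)) ⊎-dec (y ≟ᴬ swap x zero (suc k))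

-- zero is a junk value for arrangements that are not vertices.
index : Arr 4 → Fin 24
index x with any? (λ i → vertex i ≟ᴬ x)
... | yes (i , _) = i
... | no _        = zero

edgeKey : Arr 4 × Arr 4 → Fin 24 × Fin 24
edgeKey (x , y) = if does (index x ≤ᶠ? index y) then (index x , index y) else (index y , index x)

-- Through refl the evaluation is done by the conversion checker, which is far faster than
-- normalising the type True a? demanded by toWitness.
decideByEvaluation : ∀ {p} {A : Set p} (a? : Dec A) → does a? ≡ true → A
decideByEvaluation a? eq = toWitness {a? = a?} (from T-≡ (trans (isYes≗does a?) eq))

vertex-isPerm : ∀ i → IsPerm (vertex i)
vertex-isPerm = decideByEvaluation (all? λ i → unique? _≟ᶠ_ (toList (vertex i))) refl

vertex-injective : ∀ {i j} → vertex i ≡ vertex j → i ≡ j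
vertex-injective {i} {j} =
  decideByEvaluation (all? λ i → all? λ j → (vertex i ≟ᴬ vertex j) →-dec (i ≟ᶠ j)) refl i j

edges-unique : Unique edges
edges-unique = decideByEvaluation (unique? (Product.≡-dec _≟ᶠ_ _≟ᶠ_) edges) refl

edges-adjacent : All (λ (a , b) → BSAdj (vertex a) (vertex b) × BSAdj (vertex b) (vertex a)) edges
edges-adjacent = decideByEvaluation
  (All.all? (λ (a , b) → bsAdj? (vertex a) (vertex b) ×-dec bsAdj? (vertex b) (vertex a)) edges) refl

edges-keyed : All (λ (a , b) → edgeKey (vertex a , vertex b) ≡ (a , b) × edgeKey (vertex b , vertex a) ≡ (a , b))
                  edges
edges-keyed = decideByEvaluation
  (All.all? (λ (a , b) → (edgeKey (vertex a , vertex b) ≟ᴱ (a , b)) ×-dec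
                         (edgeKey (vertex b , vertex a) ≟ᴱ (a , b))) edges)
  refl
  where _≟ᴱ_ = Product.≡-dec _≟ᶠ_ _≟ᶠ_

smallOrLarge : ℕ → Bool
smallOrLarge c = (c ≤ᵇ 2) ∨ (22 ≤ᵇ c)

smallOrLarge-sound : ∀ c → T (smallOrLarge c) → c ≤ 2 ⊎ 22 ≤ c
smallOrLarge-sound c ok = Sum.map (≤ᵇ⇒≤ c 2) (≤ᵇ⇒≤ 22 c) (to T-∨ ok)

BS₄-cut-search : CutSearch.search edges 10 smallOrLarge 24 [] ≡ true
BS₄-cut-search = refl

BS₄-cut : (S : Subset 24) → length (boundary edges S) ≤ 10 → ∣ S ∣ ≤ 2 ⊎ 22 ≤ ∣ S ∣
BS₄-cut S few = smallOrLarge-sound ∣ S ∣ (CutSearch.search-correct edges 10 smallOrLarge BS₄-cut-search S few)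

module _ (F : EdgeList 4) where

  Removed : Pred (Fin 24 × Fin 24) _
  Removed (a , b) = (vertex a , vertex b) ∈ᴸ F ⊎ (vertex b , vertex a) ∈ᴸ F

  removed? : Decidable Removed
  removed? (a , b) = ((vertex a , vertex b) ∈ᴸ? F) ⊎-dec ((vertex b , vertex a) ∈ᴸ? F)
    where open DecMembership (Product.≡-dec _≟ᴬ_ _≟ᴬ_) using () renaming (_∈?_ to _∈ᴸ?_)

  open Components edges (¬? ∘ removed?)

  —⇒AdjMinus : ∀ {a b} → a — b → AdjMinus F (vertex a) (vertex b)
  —⇒AdjMinus (inj₁ (ab∈E , kept)) = proj₁ (All.lookup edges-adjacent ab∈E) , kept ∘ inj₁ , kept ∘ inj₂
  —⇒AdjMinus (inj₂ (ba∈E , kept)) = proj₂ (All.lookup edges-adjacent ba∈E) , kept ∘ inj₂ , kept ∘ inj₁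

  reach-step : ∀ {x a b} → a — b → Reach F x (vertex a) → Reach F x (vertex b)
  reach-step a—b reach = step reach (—⇒AdjMinus a—b)

  component-reach : ∀ r {i} → i ∈ component r → Reach F (vertex r) (vertex i)
  component-reach r = component-ind (λ i → Reach F (vertex r) (vertex i)) {r} here reach-step

  removed-edgeKey : ∀ {e} → e ∈ᴸ edges → Removed e → e ∈ᴸ map edgeKey F
  removed-edgeKey e∈E (inj₁ ab∈F) =
    subst (_∈ᴸ map edgeKey F) (proj₁ (All.lookup edges-keyed e∈E)) (∈-map⁺ edgeKey ab∈F)
  removed-edgeKey e∈E (inj₂ ba∈F) =
    subst (_∈ᴸ map edgeKey F) (proj₂ (All.lookup edges-keyed e∈E)) (∈-map⁺ edgeKey ba∈F)

  closed-boundary-⊆ : ∀ {S} → Closed S → boundary edges S ⊆ᴸ map edgeKey F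
  closed-boundary-⊆ {S} S-closed {e} e∈∂S =
    removed-edgeKey (proj₁ (∈-filter⁻ (T? ∘ separates edges S) {xs = edges} e∈∂S))
                    (decidable-stable (removed? e) (closed-boundary S-closed e∈∂S))

  closed-boundary-≤ : ∀ {S} → Closed S → length (boundary edges S) ≤ length F
  closed-boundary-≤ {S} S-closed = ≤-trans
    (length-mono-⊆ᴸ (Unique.filter⁺ (T? ∘ separates edges S) edges-unique) (closed-boundary-⊆ S-closed))
    (≤-reflexive (length-map edgeKey F))

  HasLargeComponent : Set
  HasLargeComponent = Σ (Arr 4) (λ r → IsPerm r × Σ (List (Arr 4)) (λ H →
    Unique H × All IsPerm H × All (Reach F r) H × length H ≥ (4 !) ∸ 2))

  large-component : ∀ r → 22 ≤ ∣ component r ∣ → HasLargeComponent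
  large-component r large =
    vertex r , vertex-isPerm r , map vertex (members C) ,
    Unique.map⁺ vertex-injective (members-unique C) ,
    All.map⁺ (All.universal vertex-isPerm (members C)) ,
    All.map⁺ (All.map (component-reach r) (members-∈ C)) ,
    subst (22 ≤_) (sym (trans (length-map vertex (members C)) (length-members C))) large
    where
    C : Subset 24
    C = component r

  module _ (few : length F ≤ 10) where

    closed-small⊎large : ∀ {S} → Closed S → ∣ S ∣ ≤ 2 ⊎ 22 ≤ ∣ S ∣
    closed-small⊎large {S} S-closed = BS₄-cut S (≤-trans (closed-boundary-≤ S-closed) few)

    grow : ∀ k (U : Subset 24) → Closed U → ∣ U ∣ ≤ 2 → 3 ≤ k + ∣ U ∣ → HasLargeComponent
    grow zero    U _        ∣U∣≤2 3≤∣U∣      = contradiction (≤-trans 3≤∣U∣ ∣U∣≤2) ≤⇒≤ᵇ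
    grow (suc k) U U-closed ∣U∣≤2 3≤1+k+∣U∣ =
      Sum.[ adjoin , large-component v ]′ (closed-small⊎large (component-closed v))
      where
      outsider : ∃ λ v → v ∉ U
      outsider = ∣p∣<n⇒∃∉ U (≤-trans (s≤s ∣U∣≤2) (≤ᵇ⇒≤ 3 24 tt))
      v : Fin 24
      v = proj₁ outsider
      U′ : Subset 24
      U′ = U ∪ component v
      grows : ∣ U ∣ < ∣ U′ ∣
      grows = p⊂q⇒∣p∣<∣q∣ (p⊆p∪q _ , v , q⊆p∪q U _ (∈-component v) , proj₂ outsider)
      U′-closed : Closed U′
      U′-closed = ∪-closed U-closed (component-closed v)
      adjoin : ∣ component v ∣ ≤ 2 → HasLargeComponent
      adjoin small = grow k U′ U′-closed ∣U′∣≤2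
        (≤-trans 3≤1+k+∣U∣ (≤-trans (≤-reflexive (sym (+-suc k ∣ U ∣))) (+-monoʳ-≤ k grows)))
        where
        ∣U′∣≤4 : ∣ U′ ∣ ≤ 4
        ∣U′∣≤4 = ≤-trans (∣p∪q∣≤∣p∣+∣q∣ U _) (+-mono-≤ ∣U∣≤2 small)
        ∣U′∣≤2 : ∣ U′ ∣ ≤ 2
        ∣U′∣≤2 = Sum.[ id , (λ 22≤∣U′∣ → contradiction (≤-trans 22≤∣U′∣ ∣U′∣≤4) ≤⇒≤ᵇ) ]′
                       (closed-small⊎large U′-closed)

    hasLargeComponent : HasLargeComponent
    hasLargeComponent = grow 3 ∅ ∅-closed z≤n ≤-refl

lemma2p6 : (F : EdgeList 4)
    → All (λ e → IsPerm (proj₁ e) × IsPerm (proj₂ e) × BSAdj (proj₁ e) (proj₂ e)) F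
    → length F ≤ 10
    → Σ (Arr 4) (λ u → Σ (Arr 4) (λ v → IsPerm u × IsPerm v × ¬ Reach F u v))
    → Σ (Arr 4) (λ r → IsPerm r × Σ (List (Arr 4)) (λ H →
    Unique H × All IsPerm H × All (Reach F r) H × length H ≥ (4 !) ∸ 2))
lemma2p6 F _ few _ = hasLargeComponent F few
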